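{- Let $t\ge2$ be an integer. The graph $H^1_{t(t-1)}$ has a model of a $K_t$ minor grasped by its underlying grid $H_{t(t-1)}$ (regarded as a $t(t-1)\times t(t-1)$ mesh).
   Context: For an integer $a\ge 1$, $[a]=\{1,\dots,a\}$. For $r\ge1$, $H_{2r}$ is the $2r\times 2r$-grid: vertex set $[2r]\times[2r]$, with $(i,j)$ adjacent to $(i',j')$ iff $|i-i'|+|j-j'|=1$. The graph $H^1_{2r}$ is obtained from $H_{2r}$ by adding, for each $i=1,\dots,2r-1$, an edge with ends $(i,r)$ and $(i+1,r+1)$ and an edge with ends $(i,r+1)$ and $(i+1,r)$; $H_{2r}$ is its underlying grid. The grid $H_{2r}$ is regarded as a mesh whose horizontal paths are $P_i=\{(i,j):j\in[2r]\}$ and vertical paths are $Q_j=\{(i,j):i\in[2r]\}$ (as induced paths). A model of a $K_t$ minor in a graph is a family of $t$ pairwise disjoint vertex sets (branch sets), each inducing a connected subgraph, with an edge between every two of them; it is grasped by the underlying grid $H_{2r}$ if $t\le 2r$ and every branch set intersects at least $t$ of the paths $P_i$ or at least $t$ of the paths $Q_j$. -}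

module Defs where

open import Data.Nat using (ℕ; suc; _+_; _*_; _≤_; _<_)
open import Data.Fin using (Fin)
open import Data.Product using (_×_; _,_; Σ; ∃; ∃-syntax)
open import Data.Sum using (_⊎_)
open import Data.Empty using (⊥)
open import Relation.Binary.PropositionalEquality using (_≡_)
open import Relation.Nullary using (¬_)
open import Function.Definitions using (Injective)

-- Vertices are pairs (i , j) of naturals; the vertex set of H_n / H^1_n
-- is [n] × [n] with [n] = {1,…,n} (1-indexed as in the paper).
Vertex : Set
Vertex = ℕ × ℕ

InRange : ℕ → ℕ → Set
InRange n i = 1 ≤ i × i ≤ n

InGrid : ℕ → Vertex → Set
InGrid n (i , j) = InRange n i × InRange n j

Neighbour : ℕ → ℕ → Set
Neighbour a b = (b ≡ suc a) ⊎ (a ≡ suc b)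

GridAdj : ℕ → Vertex → Vertex → Set
GridAdj n (i , j) (i' , j') =
  InGrid n (i , j) × InGrid n (i' , j') ×
  ((i ≡ i' × Neighbour j j') ⊎ (j ≡ j' × Neighbour i i'))

-- the added "crossing" edges of H^1_{2r}: for i = 1,…,2r-1,
-- (i,r)–(i+1,r+1) and (i,r+1)–(i+1,r)   (stated as unordered edges)
DiagEdge : ℕ → Vertex → Vertex → Set
DiagEdge r u v =
  ∃[ i ] (1 ≤ i × i + 1 ≤ 2 * r ×
    (  (u ≡ (i , r) × v ≡ (suc i , suc r))
     ⊎ (u ≡ (i , suc r) × v ≡ (suc i , r))))

Adj1 : ℕ → Vertex → Vertex → Set
Adj1 r u v = GridAdj (2 * r) u v ⊎ DiagEdge r u v ⊎ DiagEdge r v u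

VSet : Set₁
VSet = Vertex → Set

data WalkIn (A : Vertex → Vertex → Set) (B : VSet) : Vertex → Vertex → Set where
  here : ∀ {u} → B u → WalkIn A B u u
  step : ∀ {u w v} → B u → A u w → WalkIn A B w v → WalkIn A B u v

Connected : (Vertex → Vertex → Set) → VSet → Set
Connected A B = (∃[ u ] B u) × (∀ u v → B u → B v → WalkIn A B u v)

record KtModel (r t : ℕ) : Set₁ where
  field
    branch    : Fin t → VSet
    inGraph   : ∀ k v → branch k v → InGrid (2 * r) v
    connected : ∀ k → Connected (Adj1 r) (branch k)
    disjoint  : ∀ k l → ¬ (k ≡ l) → ∀ v → branch k v → branch l v → ⊥
    touching  : ∀ k l → ¬ (k ≡ l) →
                ∃[ u ] ∃[ v ] (branch k u × branch l v × Adj1 r u v)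

MeetsRow : ℕ → VSet → ℕ → Set
MeetsRow n B i = ∃[ j ] (InRange n j × B (i , j))

MeetsCol : ℕ → VSet → ℕ → Set
MeetsCol n B j = ∃[ i ] (InRange n i × B (i , j))

MeetsAtLeast : ℕ → (ℕ → Set) → ℕ → Set
MeetsAtLeast n Meets t =
  Σ (Fin t → ℕ) λ f → Injective _≡_ _≡_ f × (∀ k → InRange n (f k) × Meets (f k))

Grasped : (r t : ℕ) → KtModel r t → Set
Grasped r t M =
  t ≤ 2 * r ×
  (∀ k → MeetsAtLeast (2 * r) (MeetsRow (2 * r) (KtModel.branch M k)) t
       ⊎ MeetsAtLeast (2 * r) (MeetsCol (2 * r) (KtModel.branch M k)) t)

module Submission where

-- Write t = u + 1 with u ≥ 1, so that the grid has side 2r = t(t-1) = T (u + 1),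
-- where T s = s(s-1) = 0 + 2 + ⋯ + 2(s-1).  The rows are cut into stages
-- s = 1, …, u; stage s consists of the 2s rows  Row s h b = 1 + T s + 2h + b
-- (h < s, b a bit), taken as s pairs of rows.  The model is an insertion sort of
-- t vertical strands through the crossing columns r, r+1: when stage s begins,
-- branches 0, …, s-1 occupy s "ranks", and branch s enters as a strip zigzagging
-- down the two central columns along the crossing edges.  In row pair h, rank h
-- runs along the near half of the row to the centre (where it touches the strip
-- of branch s), crosses to the far half and runs out; the other ranks go straight
-- down.  Orientations of consecutive stages alternate, so the far half of stage s
-- is the near half of stage s+1, and `owner` records which branch holds each rank.

open import Defs
open import Data.Nat using (ℕ; zero; suc; _+_; _*_; _∸_; _≤_; _<_; z≤n; s≤s)
open import Data.Nat.Properties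
open import Data.Nat.Tactic.RingSolver using (solve-∀)
open import Data.Bool using (Bool; true; false; not)
open import Data.Bool.Properties using (not-involutive)
open import Data.Fin using (Fin; toℕ)
open import Data.Fin.Properties using (toℕ-injective; toℕ<n)
open import Data.Product using (Σ; _×_; _,_; proj₁; proj₂; ∃-syntax)
open import Data.Sum using (_⊎_; inj₁; inj₂)
open import Data.Empty using (⊥-elim)
open import Relation.Nullary using (¬_; yes; no)
open import Relation.Binary.PropositionalEquality
open import Relation.Binary.Definitions using (tri<; tri≈; tri>)

walkStart : ∀ {A B u v} → WalkIn A B u v → B u
walkStart (here b) = b
walkStart (step b _ _) = b

_++ʷ_ : ∀ {A B u v w} → WalkIn A B u v → WalkIn A B v w → WalkIn A B u w
here _ ++ʷ q = q
step b a p ++ʷ q = step b a (p ++ʷ q)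

reverseWalk : ∀ {A B} → (∀ {u v} → A u v → A v u) →
              ∀ {u v} → WalkIn A B u v → WalkIn A B v u
reverseWalk A-sym (here b) = here b
reverseWalk A-sym (step b a p) = reverseWalk A-sym p ++ʷ step (walkStart p) (A-sym a) (here b)

-- T s = s(s-1) = 0 + 2 + ⋯ + 2(s-1): the number of rows used by stages 1, …, s-1.
T : ℕ → ℕ
T zero = 0
T (suc s) = T s + (s + s)

-- The closed form shows 2r = t(t-1) is exactly the number of rows of stages 1, …, t-1.
T-closed : ∀ n → T (suc n) ≡ suc n * n
T-closed zero = refl
T-closed (suc n) = trans (cong (_+ (suc n + suc n)) (T-closed n)) (step-identity n)
  where
  step-identity : ∀ n → suc n * n + (suc n + suc n) ≡ suc (suc n) * suc n
  step-identity = solve-∀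

T-mono : ∀ {a b} → a ≤ b → T a ≤ T b
T-mono {a} {zero} z≤n = ≤-refl
T-mono {a} {suc b} a≤ with m≤n⇒m<n∨m≡n a≤
... | inj₂ refl = ≤-refl
... | inj₁ (s≤s a≤b) = ≤-trans (T-mono a≤b) (m≤m+n (T b) (b + b))

bit : Bool → ℕ
bit false = 0
bit true = 1

bit-injective : ∀ {b b'} → bit b ≡ bit b' → b ≡ b'
bit-injective {false} {false} _ = refl
bit-injective {true} {true} _ = refl
bit-injective {false} {true} ()
bit-injective {true} {false} ()

bit≤1 : ∀ b → bit b ≤ 1
bit≤1 false = z≤n
bit≤1 true = s≤s z≤n

double+bit< : ∀ {h} b {s} → h < s → h + h + bit b < s + s
double+bit< {h} b {s} h<s =
  ≤-<-trans (+-monoʳ-≤ (h + h) (bit≤1 b)) (subst (_≤ s + s) (doubleSuc h) (+-mono-≤ h<s h<s))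
  where
  doubleSuc : ∀ h → suc h + suc h ≡ suc (h + h + 1)
  doubleSuc = solve-∀

halve : ∀ m → Σ ℕ λ h → Σ Bool λ b → m ≡ h + h + bit b
halve zero = 0 , false , refl
halve (suc m) with halve m
... | h , false , e = h , true , trans (cong suc e) (makeOdd h)
  where
  makeOdd : ∀ h → suc (h + h + 0) ≡ h + h + 1
  makeOdd = solve-∀
... | h , true , e = suc h , false , trans (cong suc e) (makeEven h)
  where
  makeEven : ∀ h → suc (h + h + 1) ≡ suc h + suc h + 0
  makeEven = solve-∀

halve-unique : ∀ h b h' b' → h + h + bit b ≡ h' + h' + bit b' → h ≡ h' × b ≡ b'
halve-unique h b h' b' e with <-cmp h h'
... | tri< lt _ _ = ⊥-elim (<-irrefl e (<-≤-trans (double+bit< b lt) (m≤m+n (h' + h') (bit b'))))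
... | tri> _ _ gt = ⊥-elim (<-irrefl (sym e) (<-≤-trans (double+bit< b' gt) (m≤m+n (h + h) (bit b))))
... | tri≈ _ refl _ = refl , bit-injective (+-cancelˡ-≡ (h + h) _ _ e)

half≤ : ∀ a b → a + a ≤ b + b → a ≤ b
half≤ zero b le = z≤n
half≤ (suc a) zero ()
half≤ (suc a) (suc b) (s≤s le) = s≤s (half≤ a b (≤-pred (subst₂ _≤_ (+-suc a a) (+-suc b b) le)))

half< : ∀ {h b u} → 1 ≤ u → h + h + bit b ≤ u → h < u
half< {zero} u≥1 _ = u≥1
half< {suc h} {b} _ le = <-≤-trans (m<m+n (suc h) (s≤s z≤n)) (≤-trans (m≤m+n (suc h + suc h) (bit b)) le)

Row : ℕ → ℕ → Bool → ℕ
Row s h b = suc (T s + (h + h + bit b))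

T<Row : ∀ s h b → T s < Row s h b
T<Row s h b = s≤s (m≤m+n (T s) (h + h + bit b))

Row≤T : ∀ {s h} b → h < s → Row s h b ≤ T (suc s)
Row≤T {s} b h<s = +-monoʳ-< (T s) (double+bit< b h<s)

Row-nextBit : ∀ s h → Row s h true ≡ suc (Row s h false)
Row-nextBit s h = identity (T s) h
  where
  identity : ∀ a h → suc (a + (h + h + 1)) ≡ suc (suc (a + (h + h + 0)))
  identity = solve-∀

Row-nextPair : ∀ s h → Row s (suc h) false ≡ suc (Row s h true)
Row-nextPair s h = identity (T s) h
  where
  identity : ∀ a h → suc (a + (suc h + suc h + 0)) ≡ suc (suc (a + (h + h + 1)))
  identity = solve-∀

Row-nextStage : ∀ s → Row (suc (suc s)) 0 false ≡ suc (Row (suc s) s true)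
Row-nextStage s = identity (T (suc s)) s
  where
  identity : ∀ a x → suc (a + (suc x + suc x) + 0) ≡ suc (suc (a + (x + x + 1)))
  identity = solve-∀

Row-injective : ∀ {s h b s' h' b'} → h < s → h' < s' →
                Row s h b ≡ Row s' h' b' → s ≡ s' × h ≡ h' × b ≡ b'
Row-injective {s} {h} {b} {s'} {h'} {b'} h<s h'<s' e with <-cmp s s'
... | tri< lt _ _ = ⊥-elim (<-irrefl e (≤-<-trans (≤-trans (Row≤T b h<s) (T-mono lt)) (T<Row s' h' b')))
... | tri> _ _ gt = ⊥-elim (<-irrefl (sym e) (≤-<-trans (≤-trans (Row≤T b' h'<s') (T-mono gt)) (T<Row s h b)))
... | tri≈ _ refl _ with halve-unique h b h' b' (+-cancelˡ-≡ (T s) _ _ (suc-injective e))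
... | refl , refl = refl , refl , refl

-- owner s p: the branch holding rank p when stage s begins.  In stage s+1, rank 0
-- is the strip of stage s, and rank m+1 is the strand that left stage s at far
-- distance m+1, i.e. rank s-(m+1) of stage s.
owner : ℕ → ℕ → ℕ
owner zero p = 0
owner (suc s) zero = s
owner (suc s) (suc m) = owner s (s ∸ suc m)

owner-onto : ∀ s a → a < s → Σ ℕ λ p → p < s × owner s p ≡ a
owner-onto (suc s) a a<s with m≤n⇒m<n∨m≡n (≤-pred a<s)
... | inj₂ refl = 0 , s≤s z≤n , refl
... | inj₁ a<s' with owner-onto s a a<s'
... | p , p<s , e = suc (s ∸ suc p) , s≤s (∸-monoʳ-< {o = 0} (s≤s z≤n) p<s) ,
                    trans (cong (owner s) (reflect p<s)) e
  where
  reflect : ∀ {p s} → p < s → s ∸ suc (s ∸ suc p) ≡ p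
  reflect {p} {suc s} (s≤s p≤s) = m∸[m∸n]≡n p≤s

-- dir s: the half (true = left) that is the near side of stage s.
dir : ℕ → Bool
dir zero = false
dir (suc s) = not (dir s)

-- The near side of a stage is where ranks arrive, the far side where they leave.
data Side : Set where
  near far : Side

sideOf : Bool → Side → Bool
sideOf x near = x
sideOf x far = not x

sideOf-injective : ∀ x {side side'} → sideOf x side ≡ sideOf x side' → side ≡ side'
sideOf-injective x {near} {near} e = refl
sideOf-injective x {far} {far} e = refl
sideOf-injective true {near} {far} ()
sideOf-injective false {near} {far} ()
sideOf-injective true {far} {near} ()
sideOf-injective false {far} {near} ()

data Role : Set where
  strip : Role
  rank : ℕ → Role

branchOf : ℕ → Role → ℕ
branchOf s strip = s
branchOf s (rank p) = owner s p

-- Occupies s h b side d ρ: in row (h , b) of stage s, the vertex at distance d from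
-- the centre on the given side belongs to role ρ.  The strip takes the far centre of
-- the first row of each pair and the near centre of the second; rank p descends a
-- near column at distance p, gathers to the centre on row (p , 0), scatters out to
-- far distance s - p on row (p , 1) and descends that far column.
data Occupies (s h : ℕ) : Bool → Side → ℕ → Role → Set where
  strip₀ : Occupies s h false far 0 strip
  strip₁ : Occupies s h true near 0 strip
  nearColumn : ∀ {b p} → h < p → p < s → Occupies s h b near p (rank p)
  nearRow : ∀ {d} → d ≤ h → Occupies s h false near d (rank h)
  farRow : ∀ {q} → q + h ≤ s → Occupies s h true far q (rank h)
  farColumn : ∀ {b p q} → p < h → q + p ≡ s → Occupies s h b far q (rank p)

Occupies-unique : ∀ {s h b side d ρ ρ'} → h < s →
                  Occupies s h b side d ρ → Occupies s h b side d ρ' → ρ ≡ ρ'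
Occupies-unique h<s strip₀ strip₀ = refl
Occupies-unique h<s strip₀ (farColumn p<h e) = ⊥-elim (<-irrefl e (<-trans p<h h<s))
Occupies-unique h<s strip₁ strip₁ = refl
Occupies-unique h<s strip₁ (nearColumn () _)
Occupies-unique h<s (farColumn p<h e) strip₀ = ⊥-elim (<-irrefl e (<-trans p<h h<s))
Occupies-unique h<s (nearColumn () _) strip₁
Occupies-unique h<s (nearColumn _ _) (nearColumn _ _) = refl
Occupies-unique h<s (nearColumn h<p _) (nearRow p≤h) = ⊥-elim (<-irrefl refl (<-≤-trans h<p p≤h))
Occupies-unique h<s (nearRow p≤h) (nearColumn h<p _) = ⊥-elim (<-irrefl refl (<-≤-trans h<p p≤h))
Occupies-unique h<s (nearRow _) (nearRow _) = refl
Occupies-unique h<s (farRow _) (farRow _) = refl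
Occupies-unique {d = q} h<s (farRow le) (farColumn p<h e) =
  ⊥-elim (<-irrefl refl (<-≤-trans p<h (+-cancelˡ-≤ q _ _ (≤-trans le (≤-reflexive (sym e))))))
Occupies-unique {d = q} h<s (farColumn p<h e) (farRow le) =
  ⊥-elim (<-irrefl refl (<-≤-trans p<h (+-cancelˡ-≤ q _ _ (≤-trans le (≤-reflexive (sym e))))))
Occupies-unique {d = q} h<s (farColumn _ e) (farColumn _ e') = cong rank (+-cancelˡ-≡ q _ _ (trans e (sym e')))

module Layout (r : ℕ) where

  Adj : Vertex → Vertex → Set
  Adj = Adj1 r

  r≤2r : r ≤ 2 * r
  r≤2r = m≤m+n r (r + 0)

  neighbour-sym : ∀ {a b} → Neighbour a b → Neighbour b a
  neighbour-sym (inj₁ e) = inj₂ e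
  neighbour-sym (inj₂ e) = inj₁ e

  Adj-sym : ∀ {u v} → Adj u v → Adj v u
  Adj-sym {_ , _} {_ , _} (inj₁ (g , g' , inj₁ (e , nb))) = inj₁ (g' , g , inj₁ (sym e , neighbour-sym nb))
  Adj-sym {_ , _} {_ , _} (inj₁ (g , g' , inj₂ (e , nb))) = inj₁ (g' , g , inj₂ (sym e , neighbour-sym nb))
  Adj-sym (inj₂ (inj₁ diagonal)) = inj₂ (inj₂ diagonal)
  Adj-sym (inj₂ (inj₂ diagonal)) = inj₂ (inj₁ diagonal)

  rowEdge : ∀ {i c c'} → InGrid (2 * r) (i , c) → InGrid (2 * r) (i , c') →
            Neighbour c c' → Adj (i , c) (i , c')
  rowEdge g g' nb = inj₁ (g , g' , inj₁ (refl , nb))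

  columnEdge : ∀ {i i' c} → i ≡ suc i' → InGrid (2 * r) (i , c) → InGrid (2 * r) (i' , c) →
               Adj (i , c) (i' , c)
  columnEdge e g g' = inj₁ (g , g' , inj₂ (refl , inj₂ e))

  centre : Bool → ℕ
  centre true = r
  centre false = suc r

  centreEdge : ∀ x {i} → InGrid (2 * r) (i , centre x) → InGrid (2 * r) (i , centre (not x)) →
               Adj (i , centre x) (i , centre (not x))
  centreEdge true g g' = rowEdge g g' (inj₁ refl)
  centreEdge false g g' = rowEdge g g' (inj₂ refl)

  predBound : ∀ {i i'} → i ≡ suc i' → i ≤ 2 * r → i' + 1 ≤ 2 * r
  predBound {i' = i'} e le = subst (_≤ 2 * r) (trans e (+-comm 1 i')) le

  crossing : ∀ x y {i i'} → not x ≡ y → i ≡ suc i' → 1 ≤ i' → i ≤ 2 * r →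
             Adj (i , centre x) (i' , centre y)
  crossing true _ refl e le le' = inj₂ (inj₂ (_ , le , predBound e le' , inj₂ (refl , cong (_, r) e)))
  crossing false _ refl e le le' = inj₂ (inj₂ (_ , le , predBound e le' , inj₁ (refl , cong (_, suc r) e)))

  -- ColumnAt x d c: column c is at distance d from the centre in half x; the left
  -- half (true) consists of the columns ≤ r, the right half of the columns ≥ r + 1.
  ColumnAt : Bool → ℕ → ℕ → Set
  ColumnAt true d c = c + d ≡ r
  ColumnAt false d c = c ≡ suc (r + d)

  centre-column : ∀ x → ColumnAt x 0 (centre x)
  centre-column true = +-identityʳ r
  centre-column false = cong suc (sym (+-identityʳ r))

  column-centre : ∀ x {c} → ColumnAt x 0 c → c ≡ centre x
  column-centre true {c} e = trans (sym (+-identityʳ c)) e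
  column-centre false e = trans e (cong suc (+-identityʳ r))

  ColumnAt-functional : ∀ x {d c c'} → ColumnAt x d c → ColumnAt x d c' → c ≡ c'
  ColumnAt-functional true {d} e e' = +-cancelʳ-≡ d _ _ (trans e (sym e'))
  ColumnAt-functional false e e' = trans e (sym e')

  ColumnAt-injective : ∀ x x' {d d' c} → ColumnAt x d c → ColumnAt x' d' c → x ≡ x' × d ≡ d'
  ColumnAt-injective true true {c = c} e e' = refl , +-cancelˡ-≡ c _ _ (trans e (sym e'))
  ColumnAt-injective false false refl e' = refl , +-cancelˡ-≡ r _ _ (suc-injective e')
  ColumnAt-injective true false {d} {d'} e refl =
    ⊥-elim (<-irrefl (sym e) (≤-trans (s≤s (m≤m+n r d')) (m≤m+n _ d)))
  ColumnAt-injective false true {d} {d'} refl e' =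
    ⊥-elim (<-irrefl (sym e') (≤-trans (s≤s (m≤m+n r d)) (m≤m+n _ d')))

  columnAt : ∀ x d → d < r → Σ ℕ λ c → ColumnAt x d c × InRange (2 * r) c
  columnAt true d d<r = r ∸ d , m∸n+n≡m (<⇒≤ d<r) , m<n⇒0<n∸m d<r , ≤-trans (m∸n≤m r d) r≤2r
  columnAt false d d<r = suc (r + d) , refl , s≤s z≤n ,
    subst (_≤ 2 * r) (+-suc r d) (+-monoʳ-≤ r (subst (suc d ≤_) (sym (+-identityʳ r)) d<r))

  inward : ∀ x {d c} → ColumnAt x (suc d) c → InRange (2 * r) c →
           Σ ℕ λ c' → ColumnAt x d c' × InRange (2 * r) c' × Neighbour c c'
  inward true {d} {c} e _ =
    suc c , trans (sym (+-suc c d)) e ,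
    (s≤s z≤n , ≤-trans (≤-trans (m≤m+n (suc c) d) (≤-reflexive (trans (sym (+-suc c d)) e))) r≤2r) , inj₁ refl
  inward false {d} refl (_ , le) =
    suc (r + d) , refl , (s≤s z≤n , ≤-trans (s≤s (+-monoʳ-≤ r (n≤1+n d))) le) , inj₂ (cong suc (+-suc r d))

  sideRun : ∀ {B : VSet} x {i a} b {c c₀} → a ≤ b → ColumnAt x b c → ColumnAt x a c₀ →
            InGrid (2 * r) (i , c) →
            (∀ d {c'} → a ≤ d → d ≤ b → ColumnAt x d c' → InGrid (2 * r) (i , c') → B (i , c')) →
            WalkIn Adj B (i , c) (i , c₀)
  sideRun x b a≤b col col₀ g inB with m≤n⇒m<n∨m≡n a≤b
  sideRun x b a≤b col col₀ g inB | inj₂ refl with ColumnAt-functional x col col₀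
  ... | refl = here (inB b ≤-refl ≤-refl col g)
  sideRun x zero a≤b col col₀ g inB | inj₁ ()
  sideRun x (suc b) a≤b col col₀ g inB | inj₁ (s≤s a≤b') with inward x col (proj₂ g)
  ... | c' , col' , rc' , nb =
    step (inB (suc b) a≤b ≤-refl col g) (rowEdge g (proj₁ g , rc') nb)
         (sideRun x b a≤b' col' col₀ (proj₁ g , rc') (λ d a≤d d≤b → inB d a≤d (m≤n⇒m≤1+n d≤b)))

  record Location : Set where
    constructor loc
    field
      stage pair : ℕ
      parity : Bool
      side : Side
      distance : ℕ
      role : Role

  At : Location → Vertex → Set
  At (loc s h b side d ρ) (i , c) =
    (i ≡ Row s h b) × h < s × ColumnAt (sideOf (dir s) side) d c × Occupies s h b side d ρ

  Mem : ℕ → Vertex → Set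
  Mem k (i , c) = InGrid (2 * r) (i , c) ×
    Σ Location λ L → At L (i , c) × branchOf (Location.stage L) (Location.role L) ≡ k

  -- A vertex has only one location, so the branch sets are pairwise disjoint.
  Mem-unique : ∀ {k l i c} → Mem k (i , c) → Mem l (i , c) → k ≡ l
  Mem-unique (_ , loc s h b side d ρ , (refl , h<s , col , oc) , refl)
             (_ , loc s' h' b' side' d' ρ' , (e , h<s' , col' , oc') , refl)
    with Row-injective h<s h<s' e
  ... | refl , refl , refl with ColumnAt-injective _ _ col col'
  ... | sameHalf , refl with sideOf-injective (dir s) {side} {side'} sameHalf
  ... | refl with Occupies-unique h<s oc oc'
  ... | refl = refl

module Construction (u r : ℕ) (u≥1 : 1 ≤ u) (size : 2 * r ≡ T (suc u)) where
  open Layout r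

  r+r≡size : r + r ≡ T (suc u)
  r+r≡size = trans (cong (r +_) (sym (+-identityʳ r))) size

  -- The grid is wide enough: the u ranks of a stage fit into each half (u ≤ r, and
  -- u < r once u ≥ 2, which far columns need).
  u≤r : u ≤ r
  u≤r = half≤ u r (≤-trans (m≤n+m (u + u) (T u)) (≤-reflexive (sym r+r≡size)))

  1≤r : 1 ≤ r
  1≤r = ≤-trans u≥1 u≤r

  u<r : 2 ≤ u → u < r
  u<r 2≤u = half≤ (suc u) r
    (≤-trans (≤-reflexive (cong suc (+-suc u u)))
      (≤-trans (+-monoˡ-≤ (u + u) (T-mono 2≤u)) (≤-reflexive (sym r+r≡size))))

  Row-inRange : ∀ {s h} b → h < s → s ≤ u → InRange (2 * r) (Row s h b)
  Row-inRange b h<s s≤u =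
    s≤s z≤n , ≤-trans (≤-trans (Row≤T b h<s) (T-mono (s≤s s≤u))) (≤-reflexive (sym size))

  stage≤u : ∀ {s h b} → Row s h b ≤ 2 * r → s ≤ u
  stage≤u {s} {h} {b} le with s ≤? u
  ... | yes s≤u = s≤u
  ... | no s≰u = ⊥-elim (<-irrefl refl
          (<-≤-trans (≤-<-trans (T-mono (≰⇒> s≰u)) (T<Row s h b)) (≤-trans le (≤-reflexive size))))

  centre-inRange : ∀ x → InRange (2 * r) (centre x)
  centre-inRange true = 1≤r , r≤2r
  centre-inRange false = s≤s z≤n ,
    subst (_≤ 2 * r) (+-comm r 1) (+-monoʳ-≤ r (subst (1 ≤_) (sym (+-identityʳ r)) 1≤r))

  above : ∀ {i j c} → i ≡ suc (suc j) → InGrid (2 * r) (i , c) → InGrid (2 * r) (suc j , c)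
  above e ((_ , i≤) , rc) = (s≤s z≤n , ≤-trans (n≤1+n _) (subst (_≤ 2 * r) e i≤)) , rc

  member : ∀ {k s h b side d ρ c} → InGrid (2 * r) (Row s h b , c) → h < s →
           ColumnAt (sideOf (dir s) side) d c → Occupies s h b side d ρ → branchOf s ρ ≡ k →
           Mem k (Row s h b , c)
  member g h<s col oc ok = g , loc _ _ _ _ _ _ , (refl , h<s , col , oc) , ok

  root : ℕ → Vertex
  root zero = (Row 1 0 false , centre true)
  root (suc s) = (Row (suc s) 0 false , centre (not (dir (suc s))))

  root-member : ∀ k → k ≤ u → Mem k (root k)
  root-member zero _ =
    member (Row-inRange false (s≤s z≤n) u≥1 , centre-inRange true) (s≤s z≤n) (centre-column true) (nearRow z≤n) refl
  root-member (suc k) k<u =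
    member (Row-inRange false (s≤s z≤n) k<u , centre-inRange _) (s≤s z≤n) (centre-column (not (dir (suc k)))) strip₀ refl

  -- Connectivity: from each vertex of a branch one can move, inside the branch, to a
  -- vertex in a strictly earlier row, unless the vertex is the root.
  StepUp : ℕ → Vertex → Set
  StepUp k v = Σ Vertex λ w → Mem k w × proj₁ w < proj₁ v × WalkIn Adj (Mem k) v w

  Climbs : ℕ → Vertex → Set
  Climbs k v = v ≡ root k ⊎ StepUp k v

  edgeUp : ∀ {k v w} → proj₁ v ≡ suc (proj₁ w) → Mem k v → Mem k w → Adj v w → StepUp k v
  edgeUp e mv mw a = _ , mw , ≤-reflexive (sym e) , step mv a (here mw)

  runThen : ∀ {k i c c'} → WalkIn Adj (Mem k) (i , c) (i , c') → StepUp k (i , c') → StepUp k (i , c)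
  runThen p (w , mw , lt , q) = w , mw , lt , p ++ʷ q

  verticalUp : ∀ {k i j c} → i ≡ suc (suc j) → Mem k (i , c) →
               (InGrid (2 * r) (suc j , c) → Mem k (suc j , c)) → StepUp k (i , c)
  verticalUp {j = j} {c} e m parent = edgeUp e m (parent g') (columnEdge e (proj₁ m) g')
    where
    g' : InGrid (2 * r) (suc j , c)
    g' = above e (proj₁ m)

  crossingUp : ∀ {k i j} x y → not x ≡ y → i ≡ suc (suc j) → Mem k (i , centre x) →
               (InGrid (2 * r) (suc j , centre y) → Mem k (suc j , centre y)) →
               StepUp k (i , centre x)
  crossingUp {j = j} x y opp e m parent =
    edgeUp e m (parent g') (crossing x y opp e (s≤s z≤n) (proj₂ (proj₁ (proj₁ m))))
    where
    g' : InGrid (2 * r) (suc j , centre y)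
    g' = proj₁ (above e (proj₁ m)) , centre-inRange y

  ClimbsFrom : ℕ → ℕ → Bool → Side → ℕ → Role → Set
  ClimbsFrom s h b side d ρ = ∀ {k c} → InGrid (2 * r) (Row s h b , c) → h < s →
    ColumnAt (sideOf (dir s) side) d c → branchOf s ρ ≡ k → Climbs k (Row s h b , c)

  -- The strip zigzags up through the crossings to the root of its branch.
  climb-strip₀ : ∀ {s h} → ClimbsFrom s h false far 0 strip
  climb-strip₀ {zero} {_} _ () _ _
  climb-strip₀ {suc s} {zero} {c = c} g h<s col refl with column-centre (not (dir (suc s))) col
  ... | refl = inj₁ refl
  climb-strip₀ {s} {suc h} {c = c} g h<s col ok with column-centre (not (dir s)) col
  ... | refl = inj₂ (crossingUp (not (dir s)) (dir s) (not-involutive (dir s)) (Row-nextPair s h)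
                 (member g h<s col strip₀ ok)
                 (λ g' → member g' (<-trans (n<1+n h) h<s) (centre-column (dir s)) strip₁ ok))

  climb-strip₁ : ∀ {s h} → ClimbsFrom s h true near 0 strip
  climb-strip₁ {s} {h} {c = c} g h<s col ok with column-centre (dir s) col
  ... | refl = inj₂ (crossingUp (dir s) (not (dir s)) refl (Row-nextBit s h)
                 (member g h<s col strip₁ ok)
                 (λ g' → member g' h<s (centre-column (not (dir s))) strip₀ ok))

  -- A strand in a near column came straight down, at the top of the stage from the
  -- far half of the previous stage (its scattering row, or a far column).
  climb-nearColumn : ∀ {s h b p} → h < p → p < s → ClimbsFrom s h b near p (rank p)
  climb-nearColumn {s} {h} {true} h<p p<s g h<s col ok =
    inj₂ (verticalUp (Row-nextBit s h) (member g h<s col (nearColumn h<p p<s) ok)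
           (λ g' → member g' h<s col (nearColumn h<p p<s) ok))
  climb-nearColumn {s} {suc h} {false} h<p p<s g h<s col ok =
    inj₂ (verticalUp (Row-nextPair s h) (member g h<s col (nearColumn h<p p<s) ok)
           (λ g' → member g' (<-trans (n<1+n h) h<s) col (nearColumn (<-trans (n<1+n h) h<p) p<s) ok))
  climb-nearColumn {suc zero} {zero} {false} {suc p} _ (s≤s ()) _ _ _ _
  climb-nearColumn {suc (suc s)} {zero} {false} {suc zero} h<p p<s g h<s col ok =
    inj₂ (verticalUp (Row-nextStage s) (member g h<s col (nearColumn h<p p<s) ok)
           (λ g' → member g' (n<1+n s) col (farRow ≤-refl) ok))
  climb-nearColumn {suc (suc s)} {zero} {false} {suc (suc m)} h<p p<s@(s≤s (s≤s m<s)) g h<s col ok =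
    inj₂ (verticalUp (Row-nextStage s) (member g h<s col (nearColumn h<p p<s) ok)
           (λ g' → member g' (n<1+n s) col
                     (farColumn (∸-monoʳ-< {o = 0} (s≤s z≤n) m<s) (cong suc (m+[n∸m]≡n m<s))) ok))

  -- A strand on its gathering row runs inward to distance h, which it reached down
  -- its near column; the near centre of a stage's first row is reached through a
  -- crossing from the previous strip, except for the root of branch 0.
  climb-nearRow : ∀ {s h d} → d ≤ h → ClimbsFrom s h false near d (rank h)
  climb-nearRow {suc zero} {zero} z≤n g h<s col refl with column-centre true col
  ... | refl = inj₁ refl
  climb-nearRow {suc (suc s)} {zero} z≤n g h<s col ok with column-centre (dir (suc (suc s))) col
  ... | refl = inj₂ (crossingUp (dir (suc (suc s))) (dir (suc s)) (not-involutive (dir (suc s)))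
                 (Row-nextStage s) (member g h<s col (nearRow z≤n) ok)
                 (λ g' → member g' (n<1+n s) (centre-column (dir (suc s))) strip₁ ok))
  climb-nearRow {s} {suc h} {d} d≤h {k} {c} g h<s col ok with columnAt (dir s) (suc h) h+1<r
    where
    h+1<r : suc h < r
    h+1<r = <-≤-trans h<s (≤-trans (stage≤u {s} {suc h} {false} (proj₂ (proj₁ g))) u≤r)
  ... | ch , colh , rch =
    inj₂ (runThen (reverseWalk Adj-sym (sideRun (dir s) (suc h) d≤h colh col (proj₁ g , rch) inRow))
           (verticalUp (Row-nextPair s h) (inRow (suc h) d≤h ≤-refl colh (proj₁ g , rch))
             (λ g' → member g' (<-trans (n<1+n h) h<s) colh (nearColumn (n<1+n h) h<s) ok)))
    where
    inRow : ∀ d' {c'} → d ≤ d' → d' ≤ suc h → ColumnAt (dir s) d' c' →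
            InGrid (2 * r) (Row s (suc h) false , c') → Mem k (Row s (suc h) false , c')
    inRow d' _ d'≤ col' g' = member g' h<s col' (nearRow d'≤) ok

  -- A strand on its scattering row runs inward to the far centre, which lies across
  -- a crossing from the end of its gathering row.
  climb-farRow : ∀ {s h q} → q + h ≤ s → ClimbsFrom s h true far q (rank h)
  climb-farRow {s} {h} {q} qh≤s {k} {c} g h<s col ok =
    inj₂ (runThen (sideRun (not (dir s)) q z≤n col (centre-column (not (dir s))) g inRow)
           (crossingUp (not (dir s)) (dir s) (not-involutive (dir s)) (Row-nextBit s h)
             (inRow 0 z≤n z≤n (centre-column (not (dir s))) (proj₁ g , centre-inRange (not (dir s))))
             (λ g' → member g' h<s (centre-column (dir s)) (nearRow z≤n) ok)))
    where
    inRow : ∀ d' {c'} → 0 ≤ d' → d' ≤ q → ColumnAt (not (dir s)) d' c' →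
            InGrid (2 * r) (Row s h true , c') → Mem k (Row s h true , c')
    inRow d' _ d'≤q col' g' = member g' h<s col' (farRow (≤-trans (+-monoˡ-≤ h d'≤q) qh≤s)) ok

  -- A strand in a far column came straight down from its scattering row.
  climb-farColumn : ∀ {s h b q p} → p < h → q + p ≡ s → ClimbsFrom s h b far q (rank p)
  climb-farColumn {s} {h} {true} p<h e g h<s col ok =
    inj₂ (verticalUp (Row-nextBit s h) (member g h<s col (farColumn p<h e) ok)
           (λ g' → member g' h<s col (farColumn p<h e) ok))
  climb-farColumn {s} {zero} {false} () _ _ _ _ _
  climb-farColumn {s} {suc h} {false} p<h e g h<s col ok with m≤n⇒m<n∨m≡n (≤-pred p<h)
  ... | inj₁ p<h' = inj₂ (verticalUp (Row-nextPair s h) (member g h<s col (farColumn p<h e) ok)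
                      (λ g' → member g' (<-trans (n<1+n h) h<s) col (farColumn p<h' e) ok))
  ... | inj₂ refl = inj₂ (verticalUp (Row-nextPair s h) (member g h<s col (farColumn p<h e) ok)
                      (λ g' → member g' (<-trans (n<1+n h) h<s) col (farRow (≤-reflexive e)) ok))

  climbFrom : ∀ {s h b side d ρ} → Occupies s h b side d ρ → ClimbsFrom s h b side d ρ
  climbFrom strip₀ = climb-strip₀
  climbFrom strip₁ = climb-strip₁
  climbFrom (nearColumn h<p p<s) = climb-nearColumn h<p p<s
  climbFrom (nearRow d≤h) = climb-nearRow d≤h
  climbFrom (farRow qh≤s) = climb-farRow qh≤s
  climbFrom (farColumn p<h e) = climb-farColumn p<h e

  climb : ∀ {k i c} → Mem k (i , c) → Climbs k (i , c)
  climb (g , loc s h b side d ρ , (refl , h<s , col , oc) , ok) = climbFrom oc g h<s col ok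

  toRoot : ∀ f {k i c} → i ≤ f → Mem k (i , c) → WalkIn Adj (Mem k) (i , c) (root k)
  toRoot zero z≤n (((() , _) , _) , _)
  toRoot (suc f) {k} le m with climb m
  ... | inj₁ isRoot = subst (WalkIn Adj (Mem k) _) isRoot (here m)
  ... | inj₂ ((_ , _) , m' , lt , walk) = walk ++ʷ toRoot f (≤-pred (≤-trans lt le)) m'

  -- Branches a < b touch in stage b: on the gathering row of the rank held by a,
  -- a reaches the near centre while the strip of b occupies the far centre.
  touch : ∀ a b → a < b → b ≤ u → Σ Vertex λ x → Σ Vertex λ y → Mem a x × Mem b y × Adj x y
  touch a b a<b b≤u with owner-onto b a a<b
  ... | p , p<b , refl = _ , _ , nearCentre , farCentre , centreEdge (dir b) (proj₁ nearCentre) (proj₁ farCentre)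
    where
    nearCentre : Mem (owner b p) (Row b p false , centre (dir b))
    nearCentre = member (Row-inRange false p<b b≤u , centre-inRange _) p<b (centre-column (dir b)) (nearRow z≤n) refl
    farCentre : Mem b (Row b p false , centre (not (dir b)))
    farCentre = member (Row-inRange false p<b b≤u , centre-inRange _) p<b (centre-column (not (dir b))) strip₀ refl

  -- Within stage s, the strip of branch s meets every row …
  stripCell : ∀ {s h} b → s ≤ u → h < s → Σ ℕ λ c → Mem s (Row s h b , c)
  stripCell {s} false s≤u h<s =
    centre (not (dir s)) , member (Row-inRange false h<s s≤u , centre-inRange _) h<s (centre-column (not (dir s))) strip₀ refl
  stripCell {s} true s≤u h<s =
    centre (dir s) , member (Row-inRange true h<s s≤u , centre-inRange _) h<s (centre-column (dir s)) strip₁ refl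

  -- … and so does the strand of every rank p: down its near column above row pair p,
  -- at the centre on row pair p, and down its far column below it.
  rankCell : ∀ {s h p} b → s ≤ u → h < s → p < s → Σ ℕ λ c → Mem (owner s p) (Row s h b , c)
  rankCell {s} {h} {p} b s≤u h<s p<s with <-cmp h p
  ... | tri< h<p _ _ with columnAt (dir s) p (<-≤-trans p<s (≤-trans s≤u u≤r))
  ... | c , col , rc = c , member (Row-inRange b h<s s≤u , rc) h<s col (nearColumn h<p p<s) refl
  rankCell {s} false s≤u h<s p<s | tri≈ _ refl _ =
    centre (dir s) , member (Row-inRange false h<s s≤u , centre-inRange _) h<s (centre-column (dir s)) (nearRow z≤n) refl
  rankCell {s} true s≤u h<s p<s | tri≈ _ refl _ =
    centre (not (dir s)) , member (Row-inRange true h<s s≤u , centre-inRange _) h<s (centre-column (not (dir s))) (farRow (<⇒≤ h<s)) refl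
  rankCell {s} {h} {p} b s≤u h<s p<s | tri> _ _ p<h with columnAt (not (dir s)) (s ∸ p) farDistance<r
    where
    farDistance<r : s ∸ p < r
    farDistance<r = ≤-<-trans (≤-trans (m∸n≤m s p) s≤u)
                      (u<r (≤-trans (≤-trans (s≤s (≤-trans (s≤s z≤n) p<h)) h<s) s≤u))
  ... | c , col , rc = c , member (Row-inRange b h<s s≤u , rc) h<s col (farColumn p<h (m∸n+n≡m (<⇒≤ p<s))) refl

  meetsStage : ∀ {s h} k b → k ≤ s → s ≤ u → h < s → Σ ℕ λ c → Mem k (Row s h b , c)
  meetsStage k b k≤s s≤u h<s with m≤n⇒m<n∨m≡n k≤s
  ... | inj₂ refl = stripCell b s≤u h<s
  ... | inj₁ k<s with owner-onto _ k k<s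
  ... | p , p<s , refl = rankCell b s≤u h<s p<s

  model : KtModel r (suc u)
  model = record
    { branch = λ k → Mem (toℕ k)
    ; inGraph = λ { k (_ , _) m → proj₁ m }
    ; connected = λ k → (root (toℕ k) , root-member (toℕ k) (≤-pred (toℕ<n k))) ,
        λ { (i , c) (i' , c') m m' →
              toRoot i ≤-refl m ++ʷ reverseWalk Adj-sym (toRoot i' ≤-refl m') }
    ; disjoint = λ { k l k≢l (_ , _) m m' → k≢l (toℕ-injective (Mem-unique m m')) }
    ; touching = touching
    }
    where
    touching : ∀ (k l : Fin (suc u)) → ¬ (k ≡ l) →
               ∃[ x ] ∃[ y ] (Mem (toℕ k) x × Mem (toℕ l) y × Adj x y)
    touching k l k≢l with <-cmp (toℕ k) (toℕ l)
    ... | tri< lt _ _ = touch (toℕ k) (toℕ l) lt (≤-pred (toℕ<n l))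
    ... | tri≈ _ eq _ = ⊥-elim (k≢l (toℕ-injective eq))
    ... | tri> _ _ gt with touch (toℕ l) (toℕ k) gt (≤-pred (toℕ<n k))
    ... | x , y , ml , mk , a = y , x , mk , ml , Adj-sym a

  -- Each branch meets the first u + 1 rows T u + 1, …, T u + u + 1 of the last stage.
  grasped : Grasped r (suc u) model
  grasped = t≤size ,
    λ k → inj₁ ((λ m → suc (T u + toℕ m)) ,
                (λ e → toℕ-injective (+-cancelˡ-≡ (T u) _ _ (suc-injective e))) ,
                meetsRow k)
    where
    t≤size : suc u ≤ 2 * r
    t≤size = ≤-trans (≤-trans (≤-reflexive (+-comm 1 u)) (+-monoʳ-≤ u u≥1))
               (≤-trans (m≤n+m (u + u) (T u)) (≤-reflexive (sym size)))
    meetsRow : ∀ (k m : Fin (suc u)) →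
               InRange (2 * r) (suc (T u + toℕ m)) × MeetsRow (2 * r) (Mem (toℕ k)) (suc (T u + toℕ m))
    meetsRow k m with halve (toℕ m)
    ... | h , b , e rewrite e with meetsStage (toℕ k) b (≤-pred (toℕ<n k)) ≤-refl
                                     (half< {h} {b} u≥1 (subst (_≤ u) e (≤-pred (toℕ<n m))))
    ... | c , mem = proj₁ (proj₁ mem) , c , proj₂ (proj₁ mem) , mem

lemma3p6 : (t r : ℕ) → 2 ≤ t → 2 * r ≡ t * (t ∸ 1) →
    Σ (KtModel r t) (λ M → Grasped r t M)
lemma3p6 (suc (suc u)) r (s≤s (s≤s z≤n)) 2r≡t[t-1] =
  Construction.model (suc u) r (s≤s z≤n) size , Construction.grasped (suc u) r (s≤s z≤n) size
  where
  size : 2 * r ≡ T (suc (suc u))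
  size = trans 2r≡t[t-1] (sym (T-closed (suc u)))
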